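{- Let $Y_1,Y_2,\ldots$ be i.i.d. Bernoulli$(1/2)$ and $(Z^k)_{k\ge2}$ generated by the bit-drop scheme, independently of $Y$ (see context). Let $\gamma>0$, let $k\le n$, and let $E^n_{2k}$ be the event that every $(\pi,\eta)\in M^k$ has more than $\gamma n$ non-empty matches. Let $\sigma_k:=\sigma(Z^k_i,Y_j: i\le k,\ j\le n)$. Then, on the event $E^n_{2k}$, $$P\big(L^a_n(k+1)-L^a_n(k)=1\,\big|\,\sigma_k\big)\geq0.5\gamma.$$
   Context: Bit-drop scheme: $V_1,V_2,\ldots$ i.i.d. Bernoulli$(1/2)$; $T_3,T_4,\ldots$ independent, independent of $\{V_k\}$, $T_{k+1}$ uniform on $\{2,\ldots,k\}$; $Z^2:=V_1V_2$ and $Z^{k+1}$ is obtained from $Z^k=Z^k_1\ldots Z^k_k$ by inserting $V_{k+1}$ at position $T_{k+1}$ ($Z^{k+1}_j=Z^k_j$ for $j<T_{k+1}$, $Z^{k+1}_{T_{k+1}}=V_{k+1}$, $Z^{k+1}_j=Z^k_{j-1}$ for $j>T_{k+1}$). $L^a_n(k)$ is the length of the longest common subsequence of $Z^k$ and $Y_1\ldots Y_n$. A pair of matching subsequences of length $m$ is a pair $(\pi,\eta)$ of strictly increasing maps $\pi:\{1,\ldots,m\}\to\{1,\ldots,k\}$, $\eta:\{1,\ldots,m\}\to\{1,\ldots,n\}$ with $Z^k_{\pi(i)}=Y_{\eta(i)}$; $M^k_2$ is the set of those of maximal length; $M^k$ is the set of minimal elements of $M^k_2$ for the componentwise order ($\pi_1\le\pi_2$,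 $\eta_1\le\eta_2$ pointwise). For $1\le i\le m-1$, $(\pi(i),\pi(i+1),\eta(i),\eta(i+1))$ is a match of $(\pi,\eta)$, non-empty if $\eta(i)+2\le\eta(i+1)$.
   Formalization: The parameter γ of the event $E^n_{2k}$ ranges over the positive rationals. -}

module Defs where

open import Data.Bool using (Bool; if_then_else_)
open import Data.Nat using (ℕ; zero; suc; _+_; _*_; _∸_; _≤_; _<_; _≤ᵇ_)
open import Data.Fin using (Fin; toℕ)
import Data.Fin as F
open import Data.Vec using (Vec; lookup; insertAt)
open import Data.Product using (Σ; ∃; _×_; _,_)
open import Data.Sum using (_⊎_)
open import Data.Integer using (+_)
open import Data.Rational using (ℚ; _/_; 0ℚ)
open import Relation.Binary.PropositionalEquality using (_≡_; _≢_)
open import Function using (_∘_)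

StrictInc : ∀ {m k} → (Fin m → Fin k) → Set
StrictInc {m} f = ∀ (i j : Fin m) → toℕ i < toℕ j → toℕ (f i) < toℕ (f j)

Matching : ∀ {k n} → Vec Bool k → Vec Bool n → (m : ℕ)
         → (Fin m → Fin k) → (Fin m → Fin n) → Set
Matching z y m π η =
  StrictInc π × StrictInc η × (∀ i → lookup z (π i) ≡ lookup y (η i))

IsLCSLength : ∀ {k n} → Vec Bool k → Vec Bool n → ℕ → Set
IsLCSLength {k} {n} z y L =
  (Σ (Fin L → Fin k) λ π → Σ (Fin L → Fin n) λ η → Matching z y L π η)
  × (∀ m (π : Fin m → Fin k) (η : Fin m → Fin n) → Matching z y m π η → m ≤ L)

InM2 : ∀ {k n} → Vec Bool k → Vec Bool n → (m : ℕ)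
     → (Fin m → Fin k) → (Fin m → Fin n) → Set
InM2 z y m π η = Matching z y m π η × IsLCSLength z y m

_≼_ : ∀ {m k n} → (Fin m → Fin k) × (Fin m → Fin n)
    → (Fin m → Fin k) × (Fin m → Fin n) → Set
_≼_ {m} (π₁ , η₁) (π₂ , η₂) =
  ∀ (i : Fin m) → toℕ (π₁ i) ≤ toℕ (π₂ i) × toℕ (η₁ i) ≤ toℕ (η₂ i)

Differ : ∀ {m k n} → (Fin m → Fin k) × (Fin m → Fin n)
       → (Fin m → Fin k) × (Fin m → Fin n) → Set
Differ {m} (π₁ , η₁) (π₂ , η₂) = ∃ λ (i : Fin m) → (π₁ i ≢ π₂ i) ⊎ (η₁ i ≢ η₂ i)

InM : ∀ {k n} → Vec Bool k → Vec Bool n → (m : ℕ)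
    → (Fin m → Fin k) → (Fin m → Fin n) → Set
InM {k} {n} z y m π η =
  InM2 z y m π η
  × (∀ (π' : Fin m → Fin k) (η' : Fin m → Fin n) → InM2 z y m π' η'
       → (π' , η') ≼ (π , η) → Differ (π' , η') (π , η) → Data.Empty.⊥)
  where import Data.Empty

nonEmptyMatches : ∀ {m n} → (Fin m → Fin n) → ℕ
nonEmptyMatches {zero} η = 0
nonEmptyMatches {suc zero} η = 0
nonEmptyMatches {suc (suc m)} η =
  (if toℕ (η F.zero) + 2 ≤ᵇ toℕ (η (F.suc F.zero)) then 1 else 0)
  + nonEmptyMatches (η ∘ F.suc)

-- c / d as a rational (0 when d = 0; only used with d > 0).
_/ℕ_ : ℕ → ℕ → ℚ
c /ℕ zero = 0ℚ
c /ℕ suc d = (+ c) / suc d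

-- Outcomes (V_{k+1}, T_{k+1}) of the bit-drop step k → k+1, with the
-- insertion position T_{k+1} ∈ {2,…,k} encoded as the 0-indexed
-- t : Fin (suc k) with 1 ≤ toℕ t ≤ k - 1 (insertAt z t v puts v at
-- 1-indexed position toℕ t + 1).
ValidPos : ∀ {k} → Fin (suc k) → Set
ValidPos {k} t = 1 ≤ toℕ t × toℕ t < k

{-# OPTIONS --safe #-}
module Submission where

-- Take any (π, η) in M. One exists: every matching of length L is longest, and descending from one
-- along the componentwise order, which is decidable and well founded on the finitely many pairs of
-- maps, ends in a minimal one. A non-empty match i leaves the letter y[η(i)+1] unused strictly
-- between η(i) and η(i+1); inserting it into z right after z[π(i)], at position π(i)+1 ∈ {2,…,k},
-- extends (π, η) to a common subsequence of length L+1, while a single insertion never raises the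
-- LCS by more than one. Distinct non-empty matches give distinct insertions since π is injective,
-- so more than γn ≥ γ(k−1) of the 2(k−1) equally likely outcomes (V, T) raise the LCS.

open import Defs

module Subsequences where

  open import Data.Bool using (Bool; true; false; if_then_else_)
  import Data.Bool.Properties as Bool
  open import Data.Fin using (Fin; zero; suc; toℕ; fromℕ<; punchIn; punchOut; _<_; _≤_)
  open import Data.Fin.Properties
    using (any?; all?; _≟_; <-cmp; punchInᵢ≢i; punchIn-mono-≤; punchIn-cancel-≤; punchOut-cancel-≤;
           punchIn-punchOut; toℕ-injective; toℕ-fromℕ<; fromℕ<-cong; toℕ<n; suc-injective; 0≢1+n)
  open import Data.List using (List; []; _∷_; map; length)
  open import Data.List.Properties using (length-map)
  open import Data.List.Relation.Unary.All as All using (All; []; _∷_)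
  import Data.List.Relation.Unary.All.Properties as All
  open import Data.List.Relation.Unary.AllPairs using ([]; _∷_)
  open import Data.List.Relation.Unary.Unique.Propositional using (Unique)
  import Data.List.Relation.Unary.Unique.Propositional.Properties as Unique
  open import Data.Nat as ℕ using (ℕ; zero; suc; _+_; z≤n; s≤s; z<s; s<s; _≤ᵇ_)
  import Data.Nat.Properties as ℕ
  open import Algebra.Properties.Monoid.Sum ℕ.+-0-monoid using (sum)
  open import Data.Nat.Induction using (<-wellFounded)
  open import Data.Product using (∃; ∃₂; _×_; _,_; proj₁; proj₂)
  open import Data.Sum as Sum using (_⊎_; inj₁; inj₂)
  open import Data.Vec using (Vec; lookup; insertAt)
  import Data.Vec.Properties as Vec
  import Data.Vec.Functional as Fun
  import Data.Vec.Functional.Properties as Fun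
  open import Function using (_∘_)
  open import Function.Definitions using (Injective)
  open import Induction.WellFounded using (WellFounded; Acc; acc; module Subrelation)
  open import Level using (0ℓ)
  open import Relation.Binary using (Rel; tri<; tri≈; tri>)
  open import Relation.Binary.Definitions using (_Respects_)
  import Relation.Binary.Construct.On as On
  open import Relation.Binary.PropositionalEquality
  open import Relation.Nullary using (Dec; yes; no; ¬_; contradiction)
  open import Relation.Nullary.Decidable using (_×-dec_; _⊎-dec_; _→-dec_; ¬?; map′)
  open import Relation.Nullary.Reflects using (ofʸ)

  j<i⇒punchIn[i,j]<i : ∀ {n} {i : Fin (suc n)} {j : Fin n} → j < i → punchIn i j < i
  j<i⇒punchIn[i,j]<i {i = zero}  ()
  j<i⇒punchIn[i,j]<i {i = suc i} {zero}  _         = z<s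
  j<i⇒punchIn[i,j]<i {i = suc i} {suc j} (s<s j<i) = s<s (j<i⇒punchIn[i,j]<i j<i)

  i≤j⇒i<punchIn[i,j] : ∀ {n} {i : Fin (suc n)} {j : Fin n} → i ≤ j → i < punchIn i j
  i≤j⇒i<punchIn[i,j] {i = zero}          _         = z<s
  i≤j⇒i<punchIn[i,j] {i = suc i} {zero}  ()
  i≤j⇒i<punchIn[i,j] {i = suc i} {suc j} (s≤s i≤j) = s<s (i≤j⇒i<punchIn[i,j] i≤j)

  punchIn-mono-< : ∀ {n} (i : Fin (suc n)) {j k : Fin n} → j < k → punchIn i j < punchIn i k
  punchIn-mono-< i {j} {k} j<k = ℕ.≰⇒> (ℕ.<⇒≱ j<k ∘ punchIn-cancel-≤ i k j)

  punchOut-mono-< : ∀ {n} {i j k : Fin (suc n)} (i≢j : i ≢ j) (i≢k : i ≢ k) →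
                    j < k → punchOut i≢j < punchOut i≢k
  punchOut-mono-< i≢j i≢k j<k = ℕ.≰⇒> (ℕ.<⇒≱ j<k ∘ punchOut-cancel-≤ i≢k i≢j)

  data PunchView {n} (i : Fin (suc n)) : Fin (suc n) → Set where
    hole    : PunchView i i
    punched : (j : Fin n) → PunchView i (punchIn i j)

  punchView : ∀ {n} (i k : Fin (suc n)) → PunchView i k
  punchView i k with i ≟ k
  ... | yes refl = hole
  ... | no  i≢k  = subst (PunchView i) (punchIn-punchOut i≢k) (punched (punchOut i≢k))

  strictInc-injective : ∀ {m k} {f : Fin m → Fin k} → StrictInc f → Injective _≡_ _≡_ f
  strictInc-injective f↑ {a} {b} fa≡fb with <-cmp a b
  ... | tri< a<b _ _ = contradiction (cong toℕ fa≡fb) (ℕ.<⇒≢ (f↑ a b a<b))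
  ... | tri≈ _ a≡b _ = a≡b
  ... | tri> _ _ b<a = contradiction (cong toℕ (sym fa≡fb)) (ℕ.<⇒≢ (f↑ b a b<a))

  strictInc-mono-≤ : ∀ {m k} {f : Fin m → Fin k} → StrictInc f → ∀ {a b} → a ≤ b → f a ≤ f b
  strictInc-mono-≤ {f = f} f↑ {a} {b} a≤b with ℕ.m≤n⇒m<n∨m≡n a≤b
  ... | inj₁ a<b = ℕ.<⇒≤ (f↑ a b a<b)
  ... | inj₂ a≡b = ℕ.≤-reflexive (cong (toℕ ∘ f) (toℕ-injective a≡b))

  strictInc-resp-≗ : ∀ {m k} → StrictInc {m} {k} Respects _≗_
  strictInc-resp-≗ f≗g f↑ a b a<b = subst₂ ℕ._<_ (cong toℕ (f≗g a)) (cong toℕ (f≗g b)) (f↑ a b a<b)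

  strictInc? : ∀ {m k} (f : Fin m → Fin k) → Dec (StrictInc f)
  strictInc? f = all? λ a → all? λ b → (toℕ a ℕ.<? toℕ b) →-dec (toℕ (f a) ℕ.<? toℕ (f b))

  insertAt-strictInc : ∀ {m k} {f : Fin m → Fin k} {x : Fin k} (s : Fin (suc m)) → StrictInc f →
                       (∀ a → a < s → f a < x) → (∀ a → s ≤ a → x < f a) →
                       StrictInc (Fun.insertAt f s x)
  insertAt-strictInc {f = f} {x} s f↑ below above c d c<d with punchView s c | punchView s d
  ... | hole      | hole      = contradiction refl (ℕ.<⇒≢ c<d)
  ... | hole      | punched b =
    subst₂ _<_ (sym (Fun.insertAt-lookup f s x)) (sym (Fun.insertAt-punchIn f s x b))
      (above b (ℕ.≮⇒≥ (ℕ.<-asym c<d ∘ j<i⇒punchIn[i,j]<i)))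
  ... | punched a | hole      =
    subst₂ _<_ (sym (Fun.insertAt-punchIn f s x a)) (sym (Fun.insertAt-lookup f s x))
      (below a (ℕ.≰⇒> (ℕ.<-asym c<d ∘ i≤j⇒i<punchIn[i,j])))
  ... | punched a | punched b =
    subst₂ _<_ (sym (Fun.insertAt-punchIn f s x a)) (sym (Fun.insertAt-punchIn f s x b))
      (f↑ a b (ℕ.≰⇒> (ℕ.<⇒≱ c<d ∘ punchIn-mono-≤ s b a)))

  -- Without function extensionality the search recovers a witness only up to ≗.
  anyFunction? : ∀ {m k} {P : (Fin m → Fin k) → Set} → P Respects _≗_ →
                 (∀ f → Dec (P f)) → Dec (∃ P)
  anyFunction? {zero} {k} resp P? = map′ (empty ,_) (λ (f , p) → resp (λ ()) p) (P? empty)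
    where
    empty : Fin 0 → Fin k
    empty ()
  anyFunction? {suc m} resp P? =
    map′ (λ (a , f , p) → a Fun.∷ f , p)
         (λ (f , p) → f zero , Fun.tail f , resp (λ { zero → refl ; (suc i) → refl }) p)
         (any? λ a → anyFunction? (λ f≗g → resp (λ { zero → refl ; (suc i) → f≗g i }))
                                  (λ f → P? (a Fun.∷ f)))

  wf-minimal : ∀ {A : Set} {_⊏_ : Rel A 0ℓ} → WellFounded _⊏_ → (∀ x → Dec (∃ (_⊏ x))) →
               {P : A → Set} → (∀ {w x} → w ⊏ x → P w) →
               ∀ x → P x → ∃ λ m → P m × ∀ w → ¬ w ⊏ m
  wf-minimal {_⊏_ = _⊏_} wf ∃⊏? {P} P-below x Px = descend x Px (wf x)
    where
    descend : ∀ x → P x → Acc _⊏_ x → ∃ λ m → P m × ∀ w → ¬ w ⊏ m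
    descend x Px (acc smaller) with ∃⊏? x
    ... | no  ∄w⊏x       = x , Px , λ w w⊏x → ∄w⊏x (w , w⊏x)
    ... | yes (w , w⊏x) = descend w (P-below w⊏x) (smaller w⊏x)

  sum-mono-≤ : ∀ {m} {f g : Fin m → ℕ} → (∀ i → f i ℕ.≤ g i) → sum f ℕ.≤ sum g
  sum-mono-≤ {zero}  _   = z≤n
  sum-mono-≤ {suc m} f≤g = ℕ.+-mono-≤ (f≤g zero) (sum-mono-≤ (f≤g ∘ suc))

  sum-mono-< : ∀ {m} {f g : Fin m → ℕ} → (∀ i → f i ℕ.≤ g i) → ∀ i → f i ℕ.< g i → sum f ℕ.< sum g
  sum-mono-< f≤g zero    fi<gi = ℕ.+-mono-<-≤ fi<gi (sum-mono-≤ (f≤g ∘ suc))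
  sum-mono-< f≤g (suc i) fi<gi = ℕ.+-mono-≤-< (f≤g zero) (sum-mono-< (f≤g ∘ suc) i fi<gi)

  insertAt-matching : ∀ {k n L} {z : Vec Bool k} {y : Vec Bool n} {π η} → Matching z y L π η →
                      (s : Fin (suc L)) (t : Fin (suc k)) (j : Fin n) →
                      (∀ a → a < s → π a < t × η a < j) → (∀ a → s ≤ a → t ≤ π a × j < η a) →
                      Matching (insertAt z t (lookup y j)) y (suc L)
                               (Fun.insertAt (punchIn t ∘ π) s t) (Fun.insertAt η s j)
  insertAt-matching {k} {n} {L} {z} {y} {π} {η} (π↑ , η↑ , π≈η) s t j before after =
    insertAt-strictInc s (λ a b → punchIn-mono-< t ∘ π↑ a b)
      (λ a → j<i⇒punchIn[i,j]<i ∘ proj₁ ∘ before a) (λ a → i≤j⇒i<punchIn[i,j] ∘ proj₁ ∘ after a) ,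
    insertAt-strictInc s η↑ (λ a → proj₂ ∘ before a) (λ a → proj₂ ∘ after a) ,
    letters
    where
    v : Bool
    v = lookup y j
    z⁺ : Vec Bool (suc k)
    z⁺ = insertAt z t v
    π⁺ : Fin (suc L) → Fin (suc k)
    π⁺ = Fun.insertAt (punchIn t ∘ π) s t
    η⁺ : Fin (suc L) → Fin n
    η⁺ = Fun.insertAt η s j
    open ≡-Reasoning
    letters : ∀ c → lookup z⁺ (π⁺ c) ≡ lookup y (η⁺ c)
    letters c with punchView s c
    ... | hole = begin
      lookup z⁺ (π⁺ s) ≡⟨ cong (lookup z⁺) (Fun.insertAt-lookup (punchIn t ∘ π) s t) ⟩
      lookup z⁺ t      ≡⟨ Vec.insertAt-lookup z t v ⟩
      lookup y j       ≡⟨ cong (lookup y) (Fun.insertAt-lookup η s j) ⟨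
      lookup y (η⁺ s)  ∎
    ... | punched a = begin
      lookup z⁺ (π⁺ (punchIn s a))  ≡⟨ cong (lookup z⁺) (Fun.insertAt-punchIn (punchIn t ∘ π) s t a) ⟩
      lookup z⁺ (punchIn t (π a))   ≡⟨ Vec.insertAt-punchIn z t v (π a) ⟩
      lookup z (π a)                ≡⟨ π≈η a ⟩
      lookup y (η a)                ≡⟨ cong (lookup y) (Fun.insertAt-punchIn η s j a) ⟨
      lookup y (η⁺ (punchIn s a))   ∎

  avoiding-index : ∀ {m k} {f : Fin (suc m) → Fin k} → Injective _≡_ _≡_ f →
                   (t : Fin k) → ∃ λ d → ∀ b → t ≢ f (punchIn d b)
  avoiding-index {f = f} f-inj t with any? (λ a → f a ≟ t)
  ... | yes (d , fd≡t) = d , λ b t≡f → punchInᵢ≢i d b (f-inj (trans (sym t≡f) (sym fd≡t)))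
  ... | no  t∉f        = zero , λ b t≡f → t∉f (punchIn zero b , sym t≡f)

  module _ {k n L : ℕ} {z : Vec Bool k} {y : Vec Bool n} {t : Fin (suc k)} {v : Bool} where

    -- Dropping the pair that uses the inserted letter (any pair if none does) leaves a matching of z.
    insertAt-lcs≤ : IsLCSLength z y L → ∀ {m π η} → Matching (insertAt z t v) y m π η → m ℕ.≤ suc L
    insertAt-lcs≤ _ {zero} _ = z≤n
    insertAt-lcs≤ (_ , longest) {suc m} {π} {η} (π↑ , η↑ , π≈η) =
      s≤s (longest m π⁻ (η ∘ punchIn d) (π⁻↑ , η⁻↑ , letters))
      where
      avoid : ∃ λ d → ∀ b → t ≢ π (punchIn d b)
      avoid = avoiding-index (strictInc-injective π↑) t
      d : Fin (suc m)
      d = proj₁ avoid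
      π⁻ : Fin m → Fin k
      π⁻ b = punchOut (proj₂ avoid b)
      π⁻↑ : StrictInc π⁻
      π⁻↑ a b a<b = punchOut-mono-< (proj₂ avoid a) (proj₂ avoid b) (π↑ _ _ (punchIn-mono-< d a<b))
      η⁻↑ : StrictInc (η ∘ punchIn d)
      η⁻↑ a b a<b = η↑ _ _ (punchIn-mono-< d a<b)
      z⁺ : Vec Bool (suc k)
      z⁺ = insertAt z t v
      letters : ∀ b → lookup z (π⁻ b) ≡ lookup y (η (punchIn d b))
      letters b = begin
        lookup z (π⁻ b)               ≡⟨ Vec.insertAt-punchIn z t v (π⁻ b) ⟨
        lookup z⁺ (punchIn t (π⁻ b))  ≡⟨ cong (lookup z⁺) (punchIn-punchOut (proj₂ avoid b)) ⟩
        lookup z⁺ (π (punchIn d b))   ≡⟨ π≈η (punchIn d b) ⟩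
        lookup y (η (punchIn d b))    ∎
        where open ≡-Reasoning

    insertAt-isLCSLength : IsLCSLength z y L → ∀ {π η} → Matching (insertAt z t v) y (suc L) π η →
                           IsLCSLength (insertAt z t v) y (suc L)
    insertAt-isLCSLength lcs match = (_ , _ , match) , λ _ _ _ → insertAt-lcs≤ lcs

  letterAfter : ∀ {n} → Vec Bool n → Fin n → Bool
  letterAfter {n} y j with suc (toℕ j) ℕ.<? n
  ... | yes j+1<n = lookup y (fromℕ< j+1<n)
  ... | no  _     = false

  letterAfter-lookup : ∀ {n} (y : Vec Bool n) (j : Fin n) (j+1<n : suc (toℕ j) ℕ.< n) →
                       letterAfter y j ≡ lookup y (fromℕ< j+1<n)
  letterAfter-lookup {n} y j j+1<n with suc (toℕ j) ℕ.<? n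
  ... | yes j+1<n′ = cong (lookup y) (fromℕ<-cong _ _ refl j+1<n′ j+1<n)
  ... | no  j+1≮n  = contradiction j+1<n j+1≮n

  NonEmptyMatch : ∀ {m n} → (Fin m → Fin n) → Fin m → Set
  NonEmptyMatch η i = ∃ λ i′ → toℕ i′ ≡ suc (toℕ i) × suc (toℕ (η i)) ℕ.< toℕ (η i′)

  nonEmptyMatch-suc : ∀ {m n} {η : Fin (suc m) → Fin n} {i} →
                      NonEmptyMatch (η ∘ suc) i → NonEmptyMatch η (suc i)
  nonEmptyMatch-suc (i′ , i′≡1+i , gap) = suc i′ , cong suc i′≡1+i , gap

  nonEmptyMatches-list : ∀ {m n} → (Fin m → Fin n) → List (Fin m)
  nonEmptyMatches-list {zero}        η = []
  nonEmptyMatches-list {suc zero}    η = []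
  nonEmptyMatches-list {suc (suc m)} η =
    let later = map suc (nonEmptyMatches-list (η ∘ suc))
    in if toℕ (η zero) + 2 ≤ᵇ toℕ (η (suc zero)) then zero ∷ later else later

  length-nonEmptyMatches-list : ∀ {m n} (η : Fin m → Fin n) →
                                length (nonEmptyMatches-list η) ≡ nonEmptyMatches η
  length-nonEmptyMatches-list {zero}        η = refl
  length-nonEmptyMatches-list {suc zero}    η = refl
  length-nonEmptyMatches-list {suc (suc m)} η
    with toℕ (η zero) + 2 ≤ᵇ toℕ (η (suc zero))
       | trans (length-map Fin.suc (nonEmptyMatches-list (η ∘ suc)))
               (length-nonEmptyMatches-list (η ∘ suc))
  ... | true  | later = cong suc later
  ... | false | later = later

  nonEmptyMatches-list-sound : ∀ {m n} (η : Fin m → Fin n) →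
                               All (NonEmptyMatch η) (nonEmptyMatches-list η)
  nonEmptyMatches-list-sound {zero}        η = []
  nonEmptyMatches-list-sound {suc zero}    η = []
  nonEmptyMatches-list-sound {suc (suc m)} η
    with toℕ (η zero) + 2 ≤ᵇ toℕ (η (suc zero))
       | ℕ.≤ᵇ-reflects-≤ (toℕ (η zero) + 2) (toℕ (η (suc zero)))
       | All.map⁺ (All.map nonEmptyMatch-suc (nonEmptyMatches-list-sound (η ∘ suc)))
  ... | true  | ofʸ gap | later =
    (suc zero , refl , subst (ℕ._≤ toℕ (η (suc zero))) (ℕ.+-comm (toℕ (η zero)) 2) gap) ∷ later
  ... | false | _       | later = later

  nonEmptyMatches-list-unique : ∀ {m n} (η : Fin m → Fin n) → Unique (nonEmptyMatches-list η)
  nonEmptyMatches-list-unique {zero}        η = []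
  nonEmptyMatches-list-unique {suc zero}    η = []
  nonEmptyMatches-list-unique {suc (suc m)} η
    with toℕ (η zero) + 2 ≤ᵇ toℕ (η (suc zero))
       | Unique.map⁺ suc-injective (nonEmptyMatches-list-unique (η ∘ suc))
  ... | true  | later = All.map⁺ (All.universal (λ _ → 0≢1+n) _) ∷ later
  ... | false | later = later

  nonEmptyMatch-insertion : ∀ {k n L} {z : Vec Bool k} {y : Vec Bool n} {π η} →
                            Matching z y L π η → IsLCSLength z y L → ∀ {i} → NonEmptyMatch η i →
                            ValidPos (suc (π i)) ×
                            IsLCSLength (insertAt z (suc (π i)) (letterAfter y (η i))) y (suc L)
  nonEmptyMatch-insertion {n = n} {L} {z} {y} {π} {η} match@(π↑ , η↑ , _) lcs {i} (i′ , i′≡1+i , gap) =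
    (s≤s z≤n , ℕ.≤-<-trans (π↑ i i′ i<i′) (toℕ<n (π i′))) ,
    subst (λ v → IsLCSLength (insertAt z (suc (π i)) v) y (suc L))
          (sym (letterAfter-lookup y (η i) j<n))
          (insertAt-isLCSLength {z = z} {y} {t = suc (π i)} lcs extended)
    where
    i<i′ : i < i′
    i<i′ = ℕ.≤-reflexive (sym i′≡1+i)
    j<n : suc (toℕ (η i)) ℕ.< n
    j<n = ℕ.<-trans gap (toℕ<n (η i′))
    j : Fin n
    j = fromℕ< j<n
    before : ∀ a → a < suc i → π a < suc (π i) × η a < j
    before a (s≤s a≤i) =
      s≤s (strictInc-mono-≤ π↑ a≤i) ,
      subst (toℕ (η a) ℕ.<_) (sym (toℕ-fromℕ< j<n)) (s≤s (strictInc-mono-≤ η↑ a≤i))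
    after : ∀ a → suc i ≤ a → suc (π i) ≤ π a × j < η a
    after a i<a =
      ℕ.<-≤-trans (π↑ i i′ i<i′) (strictInc-mono-≤ π↑ i′≤a) ,
      subst (ℕ._< toℕ (η a)) (sym (toℕ-fromℕ< j<n)) (ℕ.<-≤-trans gap (strictInc-mono-≤ η↑ i′≤a))
      where
      i′≤a : i′ ≤ a
      i′≤a = subst (ℕ._≤ toℕ a) (sym i′≡1+i) i<a
    extended : Matching (insertAt z (suc (π i)) (lookup y j)) y (suc L)
                        (Fun.insertAt (punchIn (suc (π i)) ∘ π) (suc i) (suc (π i))) (Fun.insertAt η (suc i) j)
    extended = insertAt-matching {z = z} {y} match (suc i) (suc (π i)) j before after

  module _ {k n L : ℕ} (z : Vec Bool k) (y : Vec Bool n) where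

    MapPair : Set
    MapPair = (Fin L → Fin k) × (Fin L → Fin n)

    IsMatching : MapPair → Set
    IsMatching (π , η) = Matching z y L π η

    _⊏_ : Rel MapPair 0ℓ
    q ⊏ p = IsMatching q × q ≼ p × Differ q p

    weight : MapPair → ℕ
    weight (π , η) = sum λ i → toℕ (π i) + toℕ (η i)

    ⊏⇒weight< : ∀ {q p} → q ⊏ p → weight q ℕ.< weight p
    ⊏⇒weight< {π′ , η′} {π , η} (_ , q≼p , i , differ) =
      sum-mono-< (λ a → ℕ.+-mono-≤ (proj₁ (q≼p a)) (proj₂ (q≼p a))) i (strict differ)
      where
      strict : (π′ i ≢ π i) ⊎ (η′ i ≢ η i) → toℕ (π′ i) + toℕ (η′ i) ℕ.< toℕ (π i) + toℕ (η i)
      strict (inj₁ π′i≢πi) =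
        ℕ.+-mono-<-≤ (ℕ.≤∧≢⇒< (proj₁ (q≼p i)) (π′i≢πi ∘ toℕ-injective)) (proj₂ (q≼p i))
      strict (inj₂ η′i≢ηi) =
        ℕ.+-mono-≤-< (proj₁ (q≼p i)) (ℕ.≤∧≢⇒< (proj₂ (q≼p i)) (η′i≢ηi ∘ toℕ-injective))

    ⊏-wellFounded : WellFounded _⊏_
    ⊏-wellFounded = Subrelation.wellFounded ⊏⇒weight< (On.wellFounded weight <-wellFounded)

    _⊏?_ : ∀ q p → Dec (q ⊏ p)
    (π′ , η′) ⊏? (π , η) =
      (strictInc? π′ ×-dec strictInc? η′ ×-dec all? (λ a → lookup z (π′ a) Bool.≟ lookup y (η′ a))) ×-dec
      all? (λ a → (toℕ (π′ a) ℕ.≤? toℕ (π a)) ×-dec (toℕ (η′ a) ℕ.≤? toℕ (η a))) ×-dec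
      any? (λ a → ¬? (π′ a ≟ π a) ⊎-dec ¬? (η′ a ≟ η a))

    ⊏-respˡ-≗ : ∀ {π₁ π₂ η₁ η₂ p} → π₁ ≗ π₂ → η₁ ≗ η₂ → (π₁ , η₁) ⊏ p → (π₂ , η₂) ⊏ p
    ⊏-respˡ-≗ π≗ η≗ ((π↑ , η↑ , π≈η) , q≼p , i , differ) =
      (strictInc-resp-≗ π≗ π↑ , strictInc-resp-≗ η≗ η↑ ,
       λ a → subst₂ (λ b c → lookup z b ≡ lookup y c) (π≗ a) (η≗ a) (π≈η a)) ,
      (λ a → subst (ℕ._≤ _) (cong toℕ (π≗ a)) (proj₁ (q≼p a)) ,
             subst (ℕ._≤ _) (cong toℕ (η≗ a)) (proj₂ (q≼p a))) ,
      i , Sum.map (_∘ trans (π≗ i)) (_∘ trans (η≗ i)) differ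

    ∃⊏? : ∀ p → Dec (∃ (_⊏ p))
    ∃⊏? p =
      map′ (λ (π′ , η′ , q⊏p) → (π′ , η′) , q⊏p) (λ ((π′ , η′) , q⊏p) → π′ , η′ , q⊏p)
        (anyFunction? (λ π≗ (η′ , q⊏p) → η′ , ⊏-respˡ-≗ π≗ (λ _ → refl) q⊏p) λ π′ →
          anyFunction? (⊏-respˡ-≗ (λ _ → refl)) λ η′ → (π′ , η′) ⊏? p)

    M-nonempty : IsLCSLength z y L → ∃₂ λ π η → InM z y L π η
    M-nonempty lcs@((π , η , match) , _) with wf-minimal ⊏-wellFounded ∃⊏? proj₁ (π , η) match
    ... | (π₀ , η₀) , match₀ , minimal =
      π₀ , η₀ , (match₀ , lcs) ,
      λ π′ η′ (match′ , _) q≼p differ → minimal (π′ , η′) (match′ , q≼p , differ)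

open Subsequences

open import Data.Bool using (Bool)
open import Data.Nat using (ℕ; suc; _∸_)
import Data.Nat as ℕ
open import Data.Fin using (Fin)
open import Data.Vec using (Vec; insertAt)
open import Data.List using (List; length)
open import Data.List.Relation.Unary.All using (All)
open import Data.List.Relation.Unary.Unique.Propositional using (Unique)
open import Data.Product using (Σ; _×_; _,_)
open import Data.Rational using (ℚ; _<_; _≤_; _*_; _/_; ½; 0ℚ)
open import Data.Integer using (+_)

open import Data.Integer as ℤ using (-[1+_]; +≤+)
open import Data.Integer.Base using (_◃_)
import Data.Integer.Properties as ℤ
import Data.List as List
import Data.List.Properties as List
import Data.List.Relation.Unary.All as All
import Data.List.Relation.Unary.All.Properties as All
import Data.List.Relation.Unary.Unique.Propositional.Properties as Unique
import Data.Nat.Properties as ℕ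
open import Data.Nat.Tactic.RingSolver using (solve)
open import Data.Product using (proj₁; proj₂)
open import Data.Rational using (mkℚ; toℚᵘ; *<*)
import Data.Rational.Properties as ℚ
open import Data.Rational.Unnormalised as ℚᵘ using (mkℚᵘ; *≤*; *<*)
import Data.Rational.Unnormalised.Properties as ℚᵘ
open import Data.Sign using (Sign)
open import Function using (_∘_)
import Data.Fin.Properties as Fin
open import Relation.Binary.PropositionalEquality using (_≡_; sym; trans; cong; subst; subst₂)

-- A product of non-negative ℚᵘ fractions has numerator Sign.+ ◃ a, which is stuck for variable a.
*≤*ℕ : ∀ {a b c d} → a ℕ.* suc d ℕ.≤ c ℕ.* suc b → mkℚᵘ (Sign.+ ◃ a) b ℚᵘ.≤ mkℚᵘ (+ c) d
*≤*ℕ {a} {b} {c} {d} le rewrite ℤ.+◃n≡+n a =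
  *≤* (subst₂ ℤ._≤_ (ℤ.pos-* a (suc d)) (ℤ.pos-* c (suc b)) (+≤+ le))

drop-*<*ℕ : ∀ {a b c d} → mkℚᵘ (Sign.+ ◃ a) b ℚᵘ.< mkℚᵘ (+ c) d → a ℕ.* suc d ℕ.< c ℕ.* suc b
drop-*<*ℕ {a} {b} {c} {d} lt rewrite ℤ.+◃n≡+n a with lt
... | *<* lt = ℤ.drop‿+<+ (subst₂ ℤ._<_ (sym (ℤ.pos-* a (suc d))) (sym (ℤ.pos-* c (suc b))) lt)

toℚᵘ-/1 : ∀ n → toℚᵘ (+ n / 1) ℚᵘ.≃ mkℚᵘ (+ n) 0
toℚᵘ-/1 n = ℚ.toℚᵘ-fromℚᵘ (mkℚᵘ (+ n) 0)

½γ≤N/2[k∸1] : ∀ γ → 0ℚ < γ → ∀ {k n N} → 2 ℕ.≤ k → k ℕ.≤ n →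
              γ * ((+ n) / 1) < ((+ N) / 1) → ½ * γ ≤ N /ℕ (2 ℕ.* (k ∸ 1))
½γ≤N/2[k∸1] (mkℚ -[1+ _ ] _ _) (*<* ())
½γ≤N/2[k∸1] γ@(mkℚ (+ a) b _) _ {suc (suc m)} {n} {N} (ℕ.s≤s (ℕ.s≤s _)) k≤n γn<N =
  ℚ.toℚᵘ-cancel-≤ (ℚᵘ.≤-respˡ-≃ (ℚᵘ.≃-sym (ℚ.toℚᵘ-homo-* ½ γ))
                    (ℚᵘ.≤-respʳ-≃ (ℚᵘ.≃-sym (ℚ.toℚᵘ-fromℚᵘ (mkℚᵘ (+ N) _))) (*≤*ℕ cross)))
  where
  γn≃ : toℚᵘ (γ * (+ n / 1)) ℚᵘ.≃ mkℚᵘ (+ a) b ℚᵘ.* mkℚᵘ (+ n) 0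
  γn≃ = ℚᵘ.≃-trans (ℚ.toℚᵘ-homo-* γ (+ n / 1)) (ℚᵘ.*-congˡ {mkℚᵘ (+ a) b} (toℚᵘ-/1 n))
  an<Nb : a ℕ.* n ℕ.< N ℕ.* suc b
  an<Nb = subst₂ ℕ._<_ (ℕ.*-identityʳ (a ℕ.* n)) (cong (λ d → N ℕ.* suc d) (ℕ.*-identityʳ b))
    (drop-*<*ℕ (ℚᵘ.<-respˡ-≃ γn≃ (ℚᵘ.<-respʳ-≃ (toℚᵘ-/1 N) (ℚ.toℚᵘ-mono-< γn<N))))
  cross : 1 ℕ.* a ℕ.* (2 ℕ.* suc m) ℕ.≤ N ℕ.* (2 ℕ.* suc b)
  cross = begin
    1 ℕ.* a ℕ.* (2 ℕ.* suc m) ≡⟨ solve (a List.∷ m List.∷ List.[]) ⟩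
    2 ℕ.* (a ℕ.* suc m)       ≤⟨ ℕ.*-monoʳ-≤ 2 (ℕ.*-monoʳ-≤ a (ℕ.<⇒≤ k≤n)) ⟩
    2 ℕ.* (a ℕ.* n)           ≤⟨ ℕ.*-monoʳ-≤ 2 (ℕ.<⇒≤ an<Nb) ⟩
    2 ℕ.* (N ℕ.* suc b)       ≡⟨ solve (N List.∷ b List.∷ List.[]) ⟩
    N ℕ.* (2 ℕ.* suc b)       ∎
    where open ℕ.≤-Reasoning

lemma4p9 : (γ : ℚ) → 0ℚ < γ → (k n : ℕ) → 2 ℕ.≤ k → k ℕ.≤ n
    → (z : Vec Bool k) → (y : Vec Bool n)
    → (∀ m π η → InM z y m π η → γ * ((+ n) / 1) < ((+ nonEmptyMatches η) / 1))
    → (L : ℕ) → IsLCSLength z y L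
    → Σ (List (Bool × Fin (suc k))) λ S →
        Unique S
        × All (λ { (v , t) → ValidPos t × IsLCSLength (insertAt z t v) y (suc L) }) S
        × ½ * γ ≤ length S /ℕ (2 ℕ.* (k ∸ 1))
lemma4p9 γ 0<γ k n 2≤k k≤n z y many-nonEmpty L lcs =
  List.map insertion gaps ,
  Unique.map⁺ insertion-injective (nonEmptyMatches-list-unique η) ,
  All.map⁺ (All.map (nonEmptyMatch-insertion {z = z} {y} match lcs) (nonEmptyMatches-list-sound η)) ,
  subst (λ N → ½ * γ ≤ N /ℕ (2 ℕ.* (k ∸ 1))) (sym #insertions)
    (½γ≤N/2[k∸1] γ 0<γ 2≤k k≤n (many-nonEmpty L π η π,η∈M))
  where
  π : Fin L → Fin k
  π = proj₁ (M-nonempty z y lcs)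
  η : Fin L → Fin n
  η = proj₁ (proj₂ (M-nonempty z y lcs))
  π,η∈M : InM z y L π η
  π,η∈M = proj₂ (proj₂ (M-nonempty z y lcs))
  match : Matching z y L π η
  match = proj₁ (proj₁ π,η∈M)
  insertion : Fin L → Bool × Fin (suc k)
  insertion i = letterAfter y (η i) , Fin.suc (π i)
  insertion-injective : ∀ {i j} → insertion i ≡ insertion j → i ≡ j
  insertion-injective = strictInc-injective (proj₁ match) ∘ Fin.suc-injective ∘ cong proj₂
  gaps : List (Fin L)
  gaps = nonEmptyMatches-list η
  #insertions : length (List.map insertion gaps) ≡ nonEmptyMatches η
  #insertions = trans (List.length-map insertion gaps) (length-nonEmptyMatches-list η)
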